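{- Every finitary Kripke-polynomial endofunctor $T$ of $\mathbf{Pos}$ preserves finite intersections of order-embeddings: whenever $m_i:A_i\to X$ ($i$ in a finite index set) are order-embeddings with wide pullback (intersection) $P$, applying $T$ yields a wide pullback, i.e. $TP$ with the maps $T(P\to A_i)$ is the intersection of the order-embeddings $Tm_i:TA_i\to TX$.
   Context: $\mathbf{Pos}$ is the category of posets and monotone maps; an order-embedding is a monotone map that reflects the order. The finitary Kripke-polynomial functors are those generated by the grammar $T ::= E \mid \mathrm{Id} \mid T+T \mid T\times T \mid T^E \mid T^\partial \mid \mathcal{L}_\omega T$, where: $E$ (for any poset $E$) is the constant functor at $E$; $\mathrm{Id}$ the identity; $+$ and $\times$ the pointwise coproduct and product of functors; $T^E X=(TX)^E$ is the poset of monotone maps $E\to TX$ ordered pointwise, for a poset $E$; $T^\partial X=(T(X^{op}))^{op}$ with $T^\partial f = Tf$; and $\mathcal{L}_\omega X$ is the poset of finitely generated lower sets of $X$ ordered by inclusion, with $\mathcal{L}_\omega f(l)$ the lower set generated by $f[l]$. -}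

module Defs where

open import Level using (0ℓ)
open import Data.Nat using (ℕ)
open import Data.Fin using (Fin)
open import Data.Product using (Σ; _×_; _,_; proj₁; proj₂)
open import Data.Sum using (_⊎_; inj₁; inj₂)
open import Data.List using (List; [])
import Data.List as List
open import Data.List.Relation.Unary.Any using (Any; here; there)
import Data.List.Relation.Unary.Any as Any
open import Data.List.Relation.Unary.Any.Properties using (map⁺; map⁻)
open import Relation.Binary.Bundles using (Poset)
open import Data.Sum.Relation.Binary.Pointwise using (⊎-poset; inj₁; inj₂)
open import Data.Product.Relation.Binary.Pointwise.NonDependent using (×-poset)
import Relation.Binary.Construct.Flip.EqAndOrd as Flip

Pos : Set₁
Pos = Poset 0ℓ 0ℓ 0ℓ



record Mono (P Q : Pos) : Set where
  constructor mono
  field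
    fun  : Poset.Carrier P → Poset.Carrier Q
    mon  : ∀ {x y} → Poset._≤_ P x y → Poset._≤_ Q (fun x) (fun y)
open Mono public

idₘ : {P : Pos} → Mono P P
idₘ = mono (λ x → x) (λ r → r)

infixr 9 _∘ₘ_
_∘ₘ_ : {P Q R : Pos} → Mono Q R → Mono P Q → Mono P R
g ∘ₘ f = mono (λ x → fun g (fun f x)) (λ r → mon g (mon f r))

infix 4 _≗ₘ_
_≗ₘ_ : {P Q : Pos} → Mono P Q → Mono P Q → Set
_≗ₘ_ {P} {Q} f g = ∀ x → Poset._≈_ Q (fun f x) (fun g x)

IsOrderEmbedding : {P Q : Pos} → Mono P Q → Set
IsOrderEmbedding {P} {Q} f = ∀ {x y} → Poset._≤_ Q (fun f x) (fun f y) → Poset._≤_ P x y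

op : Pos → Pos
op = Flip.poset

opMono : {P Q : Pos} → Mono P Q → Mono (op P) (op Q)
opMono f = mono (fun f) (mon f)

_⇒ₚ_ : Pos → Pos → Pos
E ⇒ₚ P = record
  { Carrier = Mono E P
  ; _≈_ = λ f g → ∀ e → fun f e ≈ fun g e
  ; _≤_ = λ f g → ∀ e → fun f e ≤ fun g e
  ; isPartialOrder = record
    { isPreorder = record
      { isEquivalence = record
        { refl = λ e → Eq.refl
        ; sym = λ p e → Eq.sym (p e)
        ; trans = λ p q e → Eq.trans (p e) (q e) }
      ; reflexive = λ p e → reflexive (p e)
      ; trans = λ p q e → trans (p e) (q e) }
    ; antisym = λ p q e → antisym (p e) (q e) }
  }
  where open Poset P

-- A finitely generated lower set is presented by a finite list of
-- generators l; its elements are the x with x ≤ g for some g ∈ l.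
module _ (X : Pos) where
  open Poset X

  _∈↓_ : Carrier → List Carrier → Set
  x ∈↓ l = Any (x ≤_) l

  _⊆↓_ : List Carrier → List Carrier → Set
  l ⊆↓ l' = ∀ x → x ∈↓ l → x ∈↓ l'

Lωₚ : Pos → Pos
Lωₚ X = record
  { Carrier = List (Poset.Carrier X)
  ; _≈_ = λ l l' → (_⊆↓_ X l l') × (_⊆↓_ X l' l)
  ; _≤_ = _⊆↓_ X
  ; isPartialOrder = record
    { isPreorder = record
      { isEquivalence = record
        { refl = (λ x p → p) , (λ x p → p)
        ; sym = λ { (a , b) → b , a }
        ; trans = λ { (a , b) (c , d) → (λ x p → c x (a x p)) , (λ x p → b x (d x p)) } }
      ; reflexive = proj₁
      ; trans = λ a c x p → c x (a x p) }
    ; antisym = _,_ }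
  }


LωMono : {X Y : Pos} → Mono X Y → Mono (Lωₚ X) (Lωₚ Y)
LωMono {X} {Y} f = mono (List.map (fun f))
  (λ {l} {l'} h y p → map⁺ (go h y (map⁻ p)))
  where
  module X = Poset X
  module Y = Poset Y
  go : ∀ {l l'} → _⊆↓_ X l l' → ∀ y →
       Any (λ a → Y._≤_ y (fun f a)) l → Any (λ a → Y._≤_ y (fun f a)) l'
  go h y (here p) = Any.map (λ q → Y.trans p (mon f q)) (h _ (here X.refl))
  go h y (there a) = go (λ x q → h x (there q)) y a

data KPF : Set₁ where
  const : Pos → KPF
  Id    : KPF
  _⊕_   : KPF → KPF → KPF
  _⊗_   : KPF → KPF → KPF
  _^_   : KPF → Pos → KPF
  _^∂   : KPF → KPF
  Lω    : KPF → KPF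

obj : KPF → Pos → Pos
obj (const E) X = E
obj Id X = X
obj (S ⊕ T) X = ⊎-poset (obj S X) (obj T X)
obj (S ⊗ T) X = ×-poset (obj S X) (obj T X)
obj (T ^ E) X = E ⇒ₚ obj T X
obj (T ^∂) X = op (obj T (op X))
obj (Lω T) X = Lωₚ (obj T X)

fmap : (T : KPF) {X Y : Pos} → Mono X Y → Mono (obj T X) (obj T Y)
fmap (const E) f = idₘ
fmap Id f = f
fmap (S ⊕ T) f = mono
  (λ { (inj₁ a) → inj₁ (fun (fmap S f) a) ; (inj₂ b) → inj₂ (fun (fmap T f) b) })
  (λ { (inj₁ r) → inj₁ (mon (fmap S f) r) ; (inj₂ r) → inj₂ (mon (fmap T f) r) })
fmap (S ⊗ T) f = mono
  (λ { (a , b) → fun (fmap S f) a , fun (fmap T f) b })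
  (λ { (r , s) → mon (fmap S f) r , mon (fmap T f) s })
fmap (T ^ E) f = mono (λ g → fmap T f ∘ₘ g) (λ r e → mon (fmap T f) (r e))
fmap (T ^∂) f = opMono (fmap T (opMono f))
fmap (Lω T) f = LωMono (fmap T f)

record IsWidePullback {n : ℕ} (X : Pos) (A : Fin n → Pos)
                      (m : ∀ i → Mono (A i) X)
                      (P : Pos) (p : Mono P X) (π : ∀ i → Mono P (A i)) : Set₁ where
  field
    commutes  : ∀ i → m i ∘ₘ π i ≗ₘ p
    universal : (Q : Pos) (q : Mono Q X) (κ : ∀ i → Mono Q (A i)) →
                (∀ i → m i ∘ₘ κ i ≗ₘ q) →
                Σ (Mono Q P) λ u →
                  (p ∘ₘ u ≗ₘ q) × (∀ i → π i ∘ₘ u ≗ₘ κ i) ×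
                  (∀ (v : Mono Q P) → p ∘ₘ v ≗ₘ q → (∀ i → π i ∘ₘ v ≗ₘ κ i) → v ≗ₘ u)

-- The wide pullback of order-embeddings m i : A i → X is, up to isomorphism,
-- their set-theoretic intersection: p : P → X is an order-embedding whose
-- image contains every point lying in the image of all the m i.  This
-- concrete description is preserved by each Kripke-polynomial constructor,
-- the only delicate case being Lω.  There a finitely generated lower set L
-- presented by each m i need not have its generators in the images of the
-- m i; but every generator lies below a generator g which is, up to ≈, in
-- every image.  Such a g is found by chasing generators upwards through the
-- images and closing a cycle by the pigeonhole principle.
module Submission where

open import Defs
open import Data.Nat using (ℕ; zero; suc; _+_)
open import Data.Fin using (Fin)
open import Level using (Level; 0ℓ)

import Data.Fin as Fin
open import Data.Fin.Properties using (pigeonhole)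
open import Data.Nat.Properties using (n<1+n; m≤n⇒∃[o]m+o≡n; +-suc)
open import Data.Nat.GeneralisedArithmetic using (iterate)
open import Data.Unit using (tt)
import Data.Unit.Properties as Unit
open import Data.Bool using (false; true; f≤t; b≤b)
import Data.Bool.Properties as Bool
open import Data.Product using (Σ; ∃; _×_; _,_; proj₁; proj₂)
import Data.Product as Product
open import Data.Sum using (inj₁; inj₂)
import Data.Sum.Relation.Binary.Pointwise as Sum
open import Data.List using (List; length; lookup; tabulate)
import Data.List as List
open import Data.List.Relation.Unary.Any using (Any; index)
import Data.List.Relation.Unary.Any as Any
open import Data.List.Relation.Unary.Any.Properties
  using (map⁺; map⁻; lookup-index; tabulate⁺; tabulate⁻)
open import Data.List.Membership.Propositional using (lose)
open import Data.List.Membership.Propositional.Properties using (∈-lookup)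
open import Function using (id; _∘_)
open import Relation.Binary.Bundles using (Poset)
open import Relation.Binary.Core using (Rel)
open import Relation.Binary.Definitions using (Reflexive; Transitive)
open import Relation.Binary.PropositionalEquality as ≡ using (_≡_)

embedding-reflects-≈ : {P Q : Pos} (f : Mono P Q) → IsOrderEmbedding f →
  ∀ {x y} → Poset._≈_ Q (fun f x) (fun f y) → Poset._≈_ P x y
embedding-reflects-≈ {P} {Q} f f-emb fx≈fy =
  Poset.antisym P (f-emb (Poset.reflexive Q fx≈fy)) (f-emb (Poset.reflexive Q (Poset.Eq.sym Q fx≈fy)))

constₘ : {Q : Pos} (R : Pos) → Poset.Carrier R → Mono Q R
constₘ R r = mono (λ _ → r) (λ _ → Poset.refl R)

pairₘ : (R : Pos) (a b : Poset.Carrier R) → Poset._≤_ R a b → Mono Bool.≤-poset R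
pairₘ R a b a≤b = mono (λ { false → a ; true → b }) (λ { f≤t → a≤b ; b≤b → Poset.refl R })

InImage : {A X : Pos} → Mono A X → Poset.Carrier X → Set
InImage {A} {X} f x = Σ (Poset.Carrier A) λ a → Poset._≈_ X (fun f a) x

Covers : {n : ℕ} {X P : Pos} {A : Fin n → Pos} → (∀ i → Mono (A i) X) → Mono P X → Set
Covers m p = ∀ x → (∀ i → InImage (m i) x) → InImage p x

lift-along-embedding : {E P X : Pos} (p : Mono P X) → IsOrderEmbedding p → (x : Mono E X) →
  (∀ e → InImage p (fun x e)) → Σ (Mono E P) λ z → p ∘ₘ z ≗ₘ x
lift-along-embedding {X = X} p p-emb x pre =
  mono (proj₁ ∘ pre) (λ {e} {e'} e≤e' → p-emb (begin
    fun p (proj₁ (pre e))   ≈⟨ proj₂ (pre e) ⟩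
    fun x e                 ≤⟨ mon x e≤e' ⟩
    fun x e'                ≈⟨ Poset.Eq.sym X (proj₂ (pre e')) ⟩
    fun p (proj₁ (pre e'))  ∎)) ,
  proj₂ ∘ pre
  where open import Relation.Binary.Reasoning.PartialOrder X

module _ (X : Pos) where
  open Poset X

  lookup-∈↓ : (l : List Carrier) (j : Fin (length l)) → _∈↓_ X (lookup l j) l
  lookup-∈↓ l j = lose (∈-lookup j) refl

  ∈↓-downward : ∀ {x y l} → y ≤ x → _∈↓_ X x l → _∈↓_ X y l
  ∈↓-downward y≤x = Any.map (trans y≤x)

  map-map-⊆↓ : {V W : Set} {F : V → W} {G : W → Carrier} {H : V → Carrier} →
    (∀ a → G (F a) ≤ H a) → ∀ l → _⊆↓_ X (List.map G (List.map F l)) (List.map H l)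
  map-map-⊆↓ GF≤H l y y∈ = map⁺ (Any.map (λ y≤ → trans y≤ (GF≤H _)) (map⁻ (map⁻ y∈)))

  map-⊆↓-map-map : {V W : Set} {F : V → W} {G : W → Carrier} {H : V → Carrier} →
    (∀ a → H a ≤ G (F a)) → ∀ l → _⊆↓_ X (List.map H l) (List.map G (List.map F l))
  map-⊆↓-map-map H≤GF l y y∈ = map⁺ (map⁺ (Any.map (λ y≤ → trans y≤ (H≤GF _)) (map⁻ y∈)))

Lω-preserves-embedding : {X Y : Pos} (f : Mono X Y) → IsOrderEmbedding f →
  IsOrderEmbedding (LωMono f)
Lω-preserves-embedding f f-emb l⊆l' x x∈l =
  Any.map f-emb (map⁻ (l⊆l' _ (map⁺ (Any.map (mon f) x∈l))))

fmap-∘ : (T : KPF) {X Y Z : Pos} {f : Mono X Y} {g : Mono Y Z} {h : Mono X Z} →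
  g ∘ₘ f ≗ₘ h → fmap T g ∘ₘ fmap T f ≗ₘ fmap T h
fmap-∘ (const E) gf≈h x = Poset.Eq.refl E
fmap-∘ Id gf≈h = gf≈h
fmap-∘ (S ⊕ T) gf≈h (inj₁ x) = Sum.inj₁ (fmap-∘ S gf≈h x)
fmap-∘ (S ⊕ T) gf≈h (inj₂ y) = Sum.inj₂ (fmap-∘ T gf≈h y)
fmap-∘ (S ⊗ T) gf≈h (x , y) = fmap-∘ S gf≈h x , fmap-∘ T gf≈h y
fmap-∘ (T ^ E) gf≈h x e = fmap-∘ T gf≈h (fun x e)
fmap-∘ (T ^∂) {f = f} {g} {h} gf≈h = fmap-∘ T {f = opMono f} {opMono g} {opMono h} gf≈h
fmap-∘ (Lω T) {Z = Z} gf≈h l =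
  map-map-⊆↓ TZ (λ a → Poset.reflexive TZ (fmap-∘ T gf≈h a)) l ,
  map-⊆↓-map-map TZ (λ a → Poset.reflexive TZ (Poset.Eq.sym TZ (fmap-∘ T gf≈h a))) l
  where TZ = obj T Z

fmap-preserves-embedding : (T : KPF) {X Y : Pos} (f : Mono X Y) →
  IsOrderEmbedding f → IsOrderEmbedding (fmap T f)
fmap-preserves-embedding (const E) f f-emb = id
fmap-preserves-embedding Id f f-emb = f-emb
fmap-preserves-embedding (S ⊕ T) f f-emb {inj₁ _} {inj₁ _} (Sum.inj₁ r) =
  Sum.inj₁ (fmap-preserves-embedding S f f-emb r)
fmap-preserves-embedding (S ⊕ T) f f-emb {inj₂ _} {inj₂ _} (Sum.inj₂ r) =
  Sum.inj₂ (fmap-preserves-embedding T f f-emb r)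
fmap-preserves-embedding (S ⊗ T) f f-emb (r , s) =
  fmap-preserves-embedding S f f-emb r , fmap-preserves-embedding T f f-emb s
fmap-preserves-embedding (T ^ E) f f-emb r e = fmap-preserves-embedding T f f-emb (r e)
fmap-preserves-embedding (T ^∂) f f-emb = fmap-preserves-embedding T (opMono f) f-emb
fmap-preserves-embedding (Lω T) f f-emb =
  Lω-preserves-embedding (fmap T f) (fmap-preserves-embedding T f f-emb)

module _ {k : ℕ} {ℓ : Level} {_≼_ : Rel (Fin k) ℓ} (≼-refl : Reflexive _≼_) (≼-trans : Transitive _≼_) where

  iterate-inflationary : (R : Fin k → Fin k) → (∀ j → j ≼ R j) → ∀ j t → j ≼ iterate R j t
  iterate-inflationary R R-infl j zero = ≼-refl
  iterate-inflationary R R-infl j (suc t) = ≼-trans (R-infl j) (iterate-inflationary R R-infl (R j) t)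

  iterate-+ : (R : Fin k → Fin k) → ∀ j s t → iterate R j (s + t) ≡ iterate R (iterate R j s) t
  iterate-+ R j zero t = ≡.refl
  iterate-+ R j (suc s) t = iterate-+ R (R j) s t

  -- Among the k + 1 first iterates two coincide; the earlier one is stable.
  stable-above : (R : Fin k → Fin k) → (∀ j → j ≼ R j) → ∀ j → ∃ λ g → j ≼ g × R g ≼ g
  stable-above R R-infl j
    with s , t , s<t , Rˢ≡Rᵗ ← pigeonhole (n<1+n k) (iterate R j ∘ Fin.toℕ)
    with o , s+1+o≡t ← m≤n⇒∃[o]m+o≡n s<t =
    g , iterate-inflationary R R-infl j (Fin.toℕ s) ,
    ≡.subst (R g ≼_) R-returns-to-g (iterate-inflationary R R-infl (R g) o)
    where
    g = iterate R j (Fin.toℕ s)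
    R-returns-to-g : iterate R (R g) o ≡ g
    R-returns-to-g = begin
      iterate R g (suc o)                    ≡⟨ iterate-+ R j (Fin.toℕ s) (suc o) ⟨
      iterate R j (Fin.toℕ s + suc o)        ≡⟨ ≡.cong (iterate R j) (≡.trans (+-suc _ o) s+1+o≡t) ⟩
      iterate R j (Fin.toℕ t)                ≡⟨ Rˢ≡Rᵗ ⟨
      g                                      ∎
      where open ≡.≡-Reasoning

  round : {n : ℕ} → (Fin n → Fin k → Fin k) → Fin k → Fin k
  round {zero} R = id
  round {suc n} R = round (R ∘ Fin.suc) ∘ R Fin.zero

  round-inflationary : {n : ℕ} (R : Fin n → Fin k → Fin k) → (∀ i j → j ≼ R i j) →
    ∀ j → j ≼ round R j
  round-inflationary {zero} R R-infl j = ≼-refl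
  round-inflationary {suc n} R R-infl j =
    ≼-trans (R-infl Fin.zero j) (round-inflationary (R ∘ Fin.suc) (R-infl ∘ Fin.suc) _)

  round-visits : {n : ℕ} (R : Fin n → Fin k → Fin k) → (∀ i j → j ≼ R i j) →
    ∀ i j → ∃ λ h → j ≼ h × R i h ≼ round R j
  round-visits {suc n} R R-infl Fin.zero j =
    j , ≼-refl , round-inflationary (R ∘ Fin.suc) (R-infl ∘ Fin.suc) _
  round-visits {suc n} R R-infl (Fin.suc i) j
    with h , j≼h , Rh≼ ← round-visits (R ∘ Fin.suc) (R-infl ∘ Fin.suc) i (R Fin.zero j) =
    h , ≼-trans (R-infl Fin.zero j) j≼h , Rh≼

  jointly-stable-above : {n : ℕ} (R : Fin n → Fin k → Fin k) → (∀ i j → j ≼ R i j) →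
    ∀ j → ∃ λ g → j ≼ g × ∀ i → ∃ λ h → g ≼ h × R i h ≼ g
  jointly-stable-above R R-infl j
    with g , j≼g , round≼g ← stable-above (round R) (round-inflationary R R-infl) j =
    g , j≼g , λ i → Product.map₂ (Product.map₂ (λ Rh≼ → ≼-trans Rh≼ round≼g)) (round-visits R R-infl i g)

module _ {A Y : Pos} (f : Mono A Y) (L : List (Poset.Carrier Y)) where
  open Poset Y

  Detour : Fin (length L) → Fin (length L) → Set
  Detour j j' = Σ (Poset.Carrier A) λ b → lookup L j ≤ fun f b × fun f b ≤ lookup L j'

  Detour⇒≤ : ∀ {j j'} → Detour j j' → lookup L j ≤ lookup L j'
  Detour⇒≤ (_ , Lj≤fb , fb≤Lj') = trans Lj≤fb fb≤Lj'

  detour-cycle : ∀ {g h h'} → lookup L g ≤ lookup L h → Detour h h' → lookup L h' ≤ lookup L g →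
    InImage f (lookup L g)
  detour-cycle g≤h (b , Lh≤fb , fb≤Lh') h'≤g = b , antisym (trans fb≤Lh' h'≤g) (trans g≤h Lh≤fb)

  detour : InImage (LωMono f) L → ∀ j → Σ (Fin (length L)) (Detour j)
  detour (as , fas⊆L , L⊆fas) j =
    index fb∈↓L , b , lookup-index Lj≤fas , lookup-index fb∈↓L
    where
    Lj≤fas : Any (λ a → lookup L j ≤ fun f a) as
    Lj≤fas = map⁻ (L⊆fas _ (lookup-∈↓ Y L j))
    b : Poset.Carrier A
    b = lookup as (index Lj≤fas)
    fb∈↓L : _∈↓_ Y (fun f b) L
    fb∈↓L = fas⊆L _ (map⁺ (Any.map (mon f) (lookup-∈↓ A as (index Lj≤fas))))

module _ {n : ℕ} {Y Q : Pos} {B : Fin n → Pos} {m : ∀ i → Mono (B i) Y} {q : Mono Q Y} where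
  open Poset Y

  module _ (L : List Carrier) (L∈im : ∀ i → InImage (LωMono (m i)) L) where
    Index : Set
    Index = Fin (length L)

    _≼_ : Rel Index 0ℓ
    j ≼ j' = lookup L j ≤ lookup L j'

    step : ∀ i j → Σ Index (Detour (m i) L j)
    step i = detour (m i) L (L∈im i)

    Stable : Index → Set
    Stable g = ∀ i → ∃ λ h → g ≼ h × proj₁ (step i h) ≼ g

    stable-above-every-generator : ∀ j → ∃ λ g → j ≼ g × Stable g
    stable-above-every-generator =
      jointly-stable-above refl trans (λ i → proj₁ ∘ step i) (λ i j → Detour⇒≤ (m i) L (proj₂ (step i j)))

    stable-in-image : ∀ {g} → Stable g → ∀ i → InImage (m i) (lookup L g)
    stable-in-image visits i with h , g≼h , Rh≼g ← visits i =
      detour-cycle (m i) L g≼h (proj₂ (step i h)) Rh≼g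

    below-joint-image : ∀ j → ∃ λ g → lookup L j ≤ lookup L g × ∀ i → InImage (m i) (lookup L g)
    below-joint-image j = Product.map₂ (Product.map₂ stable-in-image) (stable-above-every-generator j)

  Lω-covers : Covers m q → Covers (λ i → LωMono (m i)) (LωMono q)
  Lω-covers q-covers L L∈im = zs , zs⊆L , L⊆zs
    where
    stable : ∀ j → ∃ λ g → lookup L j ≤ lookup L g × ∀ i → InImage (m i) (lookup L g)
    stable = below-joint-image L L∈im
    pre : ∀ j → InImage q (lookup L (proj₁ (stable j)))
    pre j = q-covers _ (proj₂ (proj₂ (stable j)))
    zs : List (Poset.Carrier Q)
    zs = tabulate (proj₁ ∘ pre)
    zs⊆L : _⊆↓_ Y (List.map (fun q) zs) L
    zs⊆L y y∈ = ∈↓-downward Y (trans y≤qz (reflexive (proj₂ (pre j)))) (lookup-∈↓ Y L (proj₁ (stable j)))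
      where
      j,y≤qz : ∃ λ j → y ≤ fun q (proj₁ (pre j))
      j,y≤qz = tabulate⁻ {f = proj₁ ∘ pre} (map⁻ {f = fun q} y∈)
      j = proj₁ j,y≤qz
      y≤qz = proj₂ j,y≤qz
    L⊆zs : _⊆↓_ Y L (List.map (fun q) zs)
    L⊆zs y y∈ = map⁺ {f = fun q} (tabulate⁺ {f = proj₁ ∘ pre} j (begin
      y                            ≤⟨ lookup-index y∈ ⟩
      lookup L j                   ≤⟨ proj₁ (proj₂ (stable j)) ⟩
      lookup L (proj₁ (stable j))  ≈⟨ Eq.sym (proj₂ (pre j)) ⟩
      fun q (proj₁ (pre j))        ∎))
      where
      j = index y∈
      open import Relation.Binary.Reasoning.PartialOrder Y

module _ (S T : KPF) {A X : Pos} (f : Mono A X) where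

  inj₁-image : ∀ {x} → InImage (fmap (S ⊕ T) f) (inj₁ x) → InImage (fmap S f) x
  inj₁-image (inj₁ a , Sum.inj₁ fa≈x) = a , fa≈x

  inj₂-image : ∀ {y} → InImage (fmap (S ⊕ T) f) (inj₂ y) → InImage (fmap T f) y
  inj₂-image (inj₂ b , Sum.inj₂ fb≈y) = b , fb≈y

fmap-covers : (T : KPF) {n : ℕ} {X P : Pos} {A : Fin n → Pos} {m : ∀ i → Mono (A i) X}
  {p : Mono P X} → IsOrderEmbedding p → Covers m p → Covers (λ i → fmap T (m i)) (fmap T p)
fmap-covers (const E) p-emb covers x _ = x , Poset.Eq.refl E
fmap-covers Id p-emb covers = covers
fmap-covers (S ⊕ T) {m = m} p-emb covers (inj₁ x) x∈im =
  Product.map inj₁ Sum.inj₁ (fmap-covers S p-emb covers x (inj₁-image S T (m _) ∘ x∈im))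
fmap-covers (S ⊕ T) {m = m} p-emb covers (inj₂ y) y∈im =
  Product.map inj₂ Sum.inj₂ (fmap-covers T p-emb covers y (inj₂-image S T (m _) ∘ y∈im))
fmap-covers (S ⊗ T) p-emb covers (x , y) xy∈im =
  Product.zip _,_ _,_
    (fmap-covers S p-emb covers x (Product.map proj₁ proj₁ ∘ xy∈im))
    (fmap-covers T p-emb covers y (Product.map proj₂ proj₂ ∘ xy∈im))
fmap-covers (T ^ E) {p = p} p-emb covers x x∈im =
  lift-along-embedding (fmap T p) (fmap-preserves-embedding T p p-emb) x
    (λ e → fmap-covers T p-emb covers (fun x e) (λ i → fun (proj₁ (x∈im i)) e , proj₂ (x∈im i) e))
fmap-covers (T ^∂) {m = m} {p} p-emb covers =
  fmap-covers T {m = λ i → opMono (m i)} {opMono p} p-emb covers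
fmap-covers (Lω T) {m = m} {p} p-emb covers =
  Lω-covers {m = λ i → fmap T (m i)} {fmap T p} (fmap-covers T p-emb covers)

record IsIntersection {n : ℕ} (X : Pos) (A : Fin n → Pos) (m : ∀ i → Mono (A i) X)
                      (P : Pos) (p : Mono P X) (π : ∀ i → Mono P (A i)) : Set where
  field
    commutes  : ∀ i → m i ∘ₘ π i ≗ₘ p
    embedding : IsOrderEmbedding p
    covers    : Covers m p

fmap-preserves-intersection : (T : KPF) {n : ℕ} {X : Pos} {A : Fin n → Pos}
  {m : ∀ i → Mono (A i) X} {P : Pos} {p : Mono P X} {π : ∀ i → Mono P (A i)} →
  IsIntersection X A m P p π →
  IsIntersection (obj T X) (λ i → obj T (A i)) (λ i → fmap T (m i))
    (obj T P) (fmap T p) (λ i → fmap T (π i))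
fmap-preserves-intersection T {p = p} I = record
  { commutes  = λ i → fmap-∘ T (commutes i)
  ; embedding = fmap-preserves-embedding T p embedding
  ; covers    = fmap-covers T embedding covers
  }
  where open IsIntersection I

module _ {n : ℕ} {X : Pos} {A : Fin n → Pos} {m : ∀ i → Mono (A i) X}
         {P : Pos} {p : Mono P X} {π : ∀ i → Mono P (A i)} where
  open Poset X using (_≈_; module Eq)

  intersection⇒wide-pullback : (∀ i → IsOrderEmbedding (m i)) →
    IsIntersection X A m P p π → IsWidePullback X A m P p π
  intersection⇒wide-pullback m-emb I = record
    { commutes  = commutes
    ; universal = λ Q q κ mκ≈q →
        let u , pu≈q = lift-along-embedding p embedding q (λ y → covers (fun q y) (λ i → fun (κ i) y , mκ≈q i y))
        in u , pu≈q ,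
           (λ i y → embedding-reflects-≈ (m i) (m-emb i)
                      (Eq.trans (commutes i (fun u y)) (Eq.trans (pu≈q y) (Eq.sym (mκ≈q i y))))) ,
           (λ v pv≈q _ y → embedding-reflects-≈ p embedding (Eq.trans (pv≈q y) (Eq.sym (pu≈q y))))
    }
    where open IsIntersection I

  module _ (wp : IsWidePullback X A m P p π) where
    open IsWidePullback wp

    wide-pullback-covers : Covers m p
    wide-pullback-covers x x∈im
      with u , pu≈x , _ ← universal Unit.≡-poset (constₘ X x) (λ i → constₘ (A i) (proj₁ (x∈im i)))
                                    (λ i _ → proj₂ (x∈im i)) =
      fun u tt , pu≈x tt

    module _ (m-emb : ∀ i → IsOrderEmbedding (m i)) where

      wide-pullback-injective : ∀ {z z'} → fun p z ≈ fun p z' → Poset._≈_ P z z'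
      wide-pullback-injective {z} {z'} pz≈pz'
        with _ , _ , _ , unique ← universal Unit.≡-poset (constₘ X (fun p z)) (λ i → constₘ (A i) (fun (π i) z))
                                            (λ i _ → commutes i z) =
        Poset.Eq.trans P (unique (constₘ P z) (λ _ → Eq.refl) (λ i _ → Poset.Eq.refl (A i)) tt)
          (Poset.Eq.sym P (unique (constₘ P z') (λ _ → Eq.sym pz≈pz') πz'≈πz tt))
        where
        πz'≈πz : ∀ i → π i ∘ₘ constₘ {Unit.≡-poset} P z' ≗ₘ constₘ (A i) (fun (π i) z)
        πz'≈πz i _ = embedding-reflects-≈ (m i) (m-emb i)
          (Eq.trans (commutes i z') (Eq.trans (Eq.sym pz≈pz') (Eq.sym (commutes i z))))

      -- The two-point chain false ≤ true probes the order of P.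
      wide-pullback-embedding : IsOrderEmbedding p
      wide-pullback-embedding {z} {z'} pz≤pz' = begin
        z            ≈⟨ wide-pullback-injective (Eq.sym (pu≈q false)) ⟩
        fun u false  ≤⟨ mon u f≤t ⟩
        fun u true   ≈⟨ wide-pullback-injective (pu≈q true) ⟩
        z'           ∎
        where
        open import Relation.Binary.Reasoning.PartialOrder P
        q : Mono Bool.≤-poset X
        q = pairₘ X (fun p z) (fun p z') pz≤pz'
        πz≤πz' : ∀ i → Poset._≤_ (A i) (fun (π i) z) (fun (π i) z')
        πz≤πz' i = m-emb i (Poset.trans X (Poset.reflexive X (commutes i z))
                             (Poset.trans X pz≤pz' (Poset.reflexive X (Eq.sym (commutes i z')))))
        κ : ∀ i → Mono Bool.≤-poset (A i)
        κ i = pairₘ (A i) (fun (π i) z) (fun (π i) z') (πz≤πz' i)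
        mκ≈q : ∀ i → m i ∘ₘ κ i ≗ₘ q
        mκ≈q i false = commutes i z
        mκ≈q i true  = commutes i z'
        u : Mono Bool.≤-poset P
        u = proj₁ (universal Bool.≤-poset q κ mκ≈q)
        pu≈q : p ∘ₘ u ≗ₘ q
        pu≈q = proj₁ (proj₂ (universal Bool.≤-poset q κ mκ≈q))

      wide-pullback⇒intersection : IsIntersection X A m P p π
      wide-pullback⇒intersection = record
        { commutes  = commutes
        ; embedding = wide-pullback-embedding
        ; covers    = wide-pullback-covers
        }

proposition3p23 : (T : KPF) {n : ℕ} (X : Pos) (A : Fin n → Pos)
    (m : ∀ i → Mono (A i) X) → (∀ i → IsOrderEmbedding (m i)) →
    (P : Pos) (p : Mono P X) (π : ∀ i → Mono P (A i)) →
    IsWidePullback X A m P p π →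
    IsWidePullback (obj T X) (λ i → obj T (A i)) (λ i → fmap T (m i))
      (obj T P) (fmap T p) (λ i → fmap T (π i))
proposition3p23 T X A m m-emb P p π wp =
  intersection⇒wide-pullback (λ i → fmap-preserves-embedding T (m i) (m-emb i))
    (fmap-preserves-intersection T (wide-pullback⇒intersection wp m-emb))
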